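{- For every integer $n\ge 1$, the Mycielski graph $M_n$ is Hamilton-connected if and only if $n\ne 3$.
   Context: For a graph $G$ with vertex set $X=\{x_1,\dots,x_n\}$, the Mycielskian $\mu(G)$ has vertex set $X\cup Y\cup\{z\}$ with $Y=\{y_1,\dots,y_n\}$ new vertices and $z$ a new vertex; its edges are the edges of $G$, the edges $zy_i$ for all $i$, and the edges $x_iy_j$ and $x_jy_i$ for every edge $x_ix_j$ of $G$. The Mycielski graphs are $M_1=K_1$, $M_2=K_2$, and $M_n=\mu(M_{n-1})$ for $n\ge 3$ (so $M_3=C_5$ and $M_4$ is the Grötzsch graph). A graph is Hamilton-connected if for every pair of distinct vertices $u,v$ there is a Hamiltonian path from $u$ to $v$. -}

module Defs where

open import Data.Nat using (ℕ; zero; suc; _+_)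
open import Data.Fin using (Fin; splitAt; zero; suc)
open import Data.Bool using (Bool; true; false; _∧_)
open import Data.Sum using (_⊎_; inj₁; inj₂)
open import Data.List using (List; []; _∷_)
open import Data.List.Membership.Propositional using (_∈_)
open import Data.List.Relation.Unary.Unique.Propositional using (Unique)
open import Relation.Binary.PropositionalEquality using (_≡_)
open import Relation.Nullary using (¬_)
open import Data.Product using (_×_; Σ; ∃-syntax)

record Graph : Set where
  field
    order : ℕ
    adj   : Fin order → Fin order → Bool
    sym   : ∀ i j → adj i j ≡ adj j i
    irrefl : ∀ i → adj i i ≡ false
open Graph public

Edge : (G : Graph) → Fin (order G) → Fin (order G) → Set
Edge G i j = adj G i j ≡ true

-- Vertices of the Mycielskian of a graph on Fin n are Fin ((n + n) + 1):
-- the first n are x_1..x_n, the next n are y_1..y_n, the last one is z.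
data MVertex (n : ℕ) : Set where
  X : Fin n → MVertex n
  Y : Fin n → MVertex n
  Z : MVertex n

classify : (n : ℕ) → Fin ((n + n) + 1) → MVertex n
classify n v with splitAt (n + n) v
... | inj₂ _ = Z
... | inj₁ w with splitAt n w
...   | inj₁ i = X i
...   | inj₂ j = Y j

mAdj : (n : ℕ) → (Fin n → Fin n → Bool) → MVertex n → MVertex n → Bool
mAdj n a (X i) (X j) = a i j
mAdj n a (X i) (Y j) = a i j
mAdj n a (Y i) (X j) = a i j
mAdj n a (Y i) (Y j) = false
mAdj n a (Y i) Z     = true
mAdj n a Z     (Y j) = true
mAdj n a (X i) Z     = false
mAdj n a Z     (X j) = false
mAdj n a Z     Z     = false

mAdj-sym : (n : ℕ) (a : Fin n → Fin n → Bool) → (∀ i j → a i j ≡ a j i) →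
           ∀ u v → mAdj n a u v ≡ mAdj n a v u
mAdj-sym n a s (X i) (X j) = s i j
mAdj-sym n a s (X i) (Y j) = s i j
mAdj-sym n a s (Y i) (X j) = s i j
mAdj-sym n a s (Y i) (Y j) = Relation.Binary.PropositionalEquality.refl
mAdj-sym n a s (Y i) Z     = Relation.Binary.PropositionalEquality.refl
mAdj-sym n a s Z     (Y j) = Relation.Binary.PropositionalEquality.refl
mAdj-sym n a s (X i) Z     = Relation.Binary.PropositionalEquality.refl
mAdj-sym n a s Z     (X j) = Relation.Binary.PropositionalEquality.refl
mAdj-sym n a s Z     Z     = Relation.Binary.PropositionalEquality.refl

mAdj-irr : (n : ℕ) (a : Fin n → Fin n → Bool) → (∀ i → a i i ≡ false) →
           ∀ u → mAdj n a u u ≡ false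
mAdj-irr n a r (X i) = r i
mAdj-irr n a r (Y i) = Relation.Binary.PropositionalEquality.refl
mAdj-irr n a r Z     = Relation.Binary.PropositionalEquality.refl

mycielskian : Graph → Graph
mycielskian G = record
  { order  = (order G + order G) + 1
  ; adj    = λ u v → mAdj (order G) (adj G) (classify (order G) u) (classify (order G) v)
  ; sym    = λ u v → mAdj-sym (order G) (adj G) (sym G) (classify (order G) u) (classify (order G) v)
  ; irrefl = λ u → mAdj-irr (order G) (adj G) (irrefl G) (classify (order G) u)
  }

K1 : Graph
K1 = record { order = 1 ; adj = λ _ _ → false
            ; sym = λ _ _ → Relation.Binary.PropositionalEquality.refl
            ; irrefl = λ _ → Relation.Binary.PropositionalEquality.refl }

k2adj : Fin 2 → Fin 2 → Bool
k2adj zero zero = false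
k2adj zero (suc zero) = true
k2adj (suc zero) zero = true
k2adj (suc zero) (suc zero) = false

K2 : Graph
K2 = record { order = 2 ; adj = k2adj ; sym = s ; irrefl = r }
  where
  open Relation.Binary.PropositionalEquality using (refl)
  s : ∀ i j → k2adj i j ≡ k2adj j i
  s zero zero = refl
  s zero (suc zero) = refl
  s (suc zero) zero = refl
  s (suc zero) (suc zero) = refl
  r : ∀ i → k2adj i i ≡ false
  r zero = refl
  r (suc zero) = refl

-- Mycielski graphs, indexed from 1: Mycielski 1 = M_1 = K_1, Mycielski 2 = M_2 = K_2,
-- Mycielski (suc n) = μ(Mycielski n) for n ≥ 2.  (Mycielski 0 is an unused dummy, K_1.)
Mycielski : ℕ → Graph
Mycielski zero = K1
Mycielski (suc zero) = K1
Mycielski (suc (suc zero)) = K2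
Mycielski (suc (suc (suc n))) = mycielskian (Mycielski (suc (suc n)))

data PathFromTo (G : Graph) : Fin (order G) → Fin (order G) → List (Fin (order G)) → Set where
  single : ∀ u → PathFromTo G u u (u ∷ [])
  step   : ∀ {u w v ps} → Edge G u w → PathFromTo G w v ps → PathFromTo G u v (u ∷ ps)

HamiltonianPath : (G : Graph) → Fin (order G) → Fin (order G) → Set
HamiltonianPath G u v =
  Σ (List (Fin (order G))) λ ps →
    PathFromTo G u v ps × Unique ps × (∀ w → w ∈ ps)

HamiltonConnected : Graph → Set
HamiltonConnected G = ∀ (u v : Fin (order G)) → ¬ (u ≡ v) → HamiltonianPath G u v

module Submission where

-- M₁, M₂ and the Grötzsch graph M₄ are Hamilton-connected and M₃ = C₅ is not; these cases
-- are settled by computation.  As |μ(G)| = 2|G| + 1 is odd, the rest follows by induction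
-- from: if G is Hamilton-connected of odd order N ≥ 5, then so is μ(G).  A walk of G lifts
-- to μ(G) by alternating between the copies x_i and y_i of its vertices, and the parity of
-- its number of inner vertices decides on which copy it ends.  Between two vertices of μ(G)
-- that are not both x's, take a Hamiltonian path p, p′, …, q′, q of G: its middle part
-- p′ ⇝ q′ has N − 4 inner vertices, an odd number, and its two lifts are spliced together
-- through z and the copies of p, p′, q′, q.  Between x_a and x_b, cut a Hamiltonian cycle of
-- G at a and b; as N is odd, one arc has an even and the other an odd number of inner
-- vertices, and lifts of the two arcs joined through z, y_b and y_a give the path.

open import Defs
open import Data.Nat using (ℕ; zero; suc; _+_; _≤_; _≥_; z≤n; s≤s)
open import Data.Nat.Properties using (+-suc; ≤-trans; m≤m+n; +-mono-≤; +-monoˡ-≤)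
open import Data.Nat.DivMod using (_mod_)
open import Data.Fin using (Fin; zero; suc; _≟_; #_; splitAt; _↑ˡ_; _↑ʳ_)
open import Data.Fin.Properties using (all?; splitAt-↑ˡ; splitAt-↑ʳ; splitAt⁻¹-↑ˡ; splitAt⁻¹-↑ʳ)
open import Data.Bool using (Bool; true; false; not; _xor_)
import Data.Bool.Properties as Bool
open import Data.Bool.Properties using (not-involutive; not-distribˡ-xor; xor-same; xor-identityʳ)
open import Data.Product using (Σ-syntax; ∃-syntax; _×_; _,_; proj₁; proj₂)
open import Data.Sum using (_⊎_; inj₁; inj₂)
open import Data.List using (List; []; _∷_; _++_; _∷ʳ_; reverse; length; map; allFin; initLast; _∷ʳ′_)
open import Data.List.Properties using (length-tabulate; length-++; length-reverse; ++-assoc; unfold-reverse; reverse-++)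
open import Data.List.Membership.Propositional using (_∈_; _∉_)
open import Data.List.Membership.Propositional.Properties using (∈-allFin; ∈-∃++; ∈-map⁺)
open import Data.List.Membership.Propositional.Properties.WithK using (unique∧set⇒bag)
open import Data.List.Relation.Unary.Any using (Any; here; there; any?; satisfied)
open import Data.List.Relation.Unary.All using (_∷_)
open import Data.List.Relation.Unary.All.Properties using (¬Any⇒All¬)
open import Data.List.Relation.Unary.Unique.Propositional using (Unique; []; _∷_)
open import Data.List.Relation.Unary.Unique.Propositional.Properties using (allFin⁺; map⁺; Unique[x∷xs]⇒x∉xs)
open import Data.List.Relation.Binary.Permutation.Propositional
  using (_↭_; prep; ↭-refl; ↭-sym; ↭-trans; ↭-reflexive; ↭⇒↭ₛ; module PermutationReasoning)
open import Data.List.Relation.Binary.Permutation.Propositional.Properties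
  using (∈-resp-↭; ↭-length; shift; ∷↭∷ʳ; ++-comm; ++⁺; ++⁺ˡ; ++⁺ʳ; ↭-reverse; ++-commutativeMonoid)
open import Data.List.Relation.Binary.BagAndSetEquality using (∼bag⇒↭)
import Data.List.Relation.Binary.Permutation.Setoid.Properties as PermutationSetoid
import Algebra.Solver.CommutativeMonoid as CommutativeMonoidSolver
open import Data.Vec using (Vec; []; _∷_)
open import Function using (_∘_)
open import Function.Bundles using (_⇔_; mk⇔)
open import Relation.Nullary using (¬_; Dec; yes; no; contradiction)
open import Relation.Nullary.Decidable using (map′; _×-dec_; _⊎-dec_; toWitness; ¬?; True)
open import Relation.Binary.PropositionalEquality as ≡ using (_≡_; _≢_; refl; cong; subst)

Listing : {A : Set} → List A → Set
Listing {A} xs = Unique xs × (∀ a → a ∈ xs)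

Listing-resp-↭ : {A : Set} {xs ys : List A} → xs ↭ ys → Listing xs → Listing ys
Listing-resp-↭ {A} xs↭ys (unique , complete) =
  PermutationSetoid.Unique-resp-↭ (≡.setoid A) (↭⇒↭ₛ xs↭ys) unique ,
  λ a → ∈-resp-↭ xs↭ys (complete a)

length-Listing : ∀ {n} {xs : List (Fin n)} → Listing xs → length xs ≡ n
length-Listing {n} {xs} (unique , complete) = ≡.trans (↭-length xs↭allFin) (length-tabulate _)
  where
  xs↭allFin : xs ↭ allFin n
  xs↭allFin = ∼bag⇒↭ (unique∧set⇒bag unique (allFin⁺ n) λ {i} →
                mk⇔ (λ _ → ∈-allFin i) (λ _ → complete i))

another : ∀ {n} → 2 ≤ n → (i : Fin n) → ∃[ j ] i ≢ j
another (s≤s (s≤s _)) zero    = suc zero , λ ()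
another (s≤s (s≤s _)) (suc _) = zero , λ ()

odd : ℕ → Bool
odd zero    = false
odd (suc n) = not (odd n)

odd-+ : ∀ m n → odd (m + n) ≡ odd m xor odd n
odd-+ zero    n = refl
odd-+ (suc m) n = ≡.trans (cong not (odd-+ m n)) (not-distribˡ-xor (odd m) (odd n))

odd-+2 : ∀ n → odd (suc (suc n)) ≡ odd n
odd-+2 n = not-involutive (odd n)

odd-double+1 : ∀ n → odd ((n + n) + 1) ≡ true
odd-double+1 n rewrite odd-+ (n + n) 1 | odd-+ n n | xor-same (odd n) = refl

not-xor-not : ∀ p t → not p xor not t ≡ p xor t
not-xor-not true  t = refl
not-xor-not false t = not-involutive t

-- Only the inner vertices of a walk are recorded, so that walks compose without repeating
-- the vertex where they meet.
data Walk {A : Set} (R : A → A → Set) : A → A → List A → Set where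
  edge : ∀ {x y} → R x y → Walk R x y []
  via  : ∀ {x y z zs} → R x z → Walk R z y zs → Walk R x y (z ∷ zs)

HamiltonianWalk : {A : Set} → (A → A → Set) → A → A → Set
HamiltonianWalk {A} R x y = Σ[ zs ∈ List A ] Walk R x y zs × Listing (x ∷ zs ∷ʳ y)

module _ {A : Set} {R : A → A → Set} where

  infixr 5 _⊙_
  _⊙_ : ∀ {x y z xs ys} → Walk R x y xs → Walk R y z ys → Walk R x z (xs ++ y ∷ ys)
  edge r  ⊙ q = via r q
  via r p ⊙ q = via r (p ⊙ q)

  walk-split : ∀ {x z} xs {y ys} → Walk R x z (xs ++ y ∷ ys) → Walk R x y xs × Walk R y z ys
  walk-split []       (via r q) = edge r , q
  walk-split (_ ∷ xs) (via r p) with walk-split xs p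
  ... | p₁ , p₂ = via r p₁ , p₂

  first-step : ∀ {x y zs} → Walk R x y zs → ∃[ w ] R x w
  first-step (edge r)  = _ , r
  first-step (via r _) = _ , r

  module _ (R-sym : ∀ {x y} → R x y → R y x) where

    walk-reverse : ∀ {x y zs} → Walk R x y zs → Walk R y x (reverse zs)
    walk-reverse (edge r) = edge (R-sym r)
    walk-reverse (via {z = z} {zs = zs} r p) =
      subst (Walk R _ _) (≡.sym (unfold-reverse z zs)) (walk-reverse p ⊙ edge (R-sym r))

    hamiltonianWalk-reverse : ∀ {x y} → HamiltonianWalk R x y → HamiltonianWalk R y x
    hamiltonianWalk-reverse {x} {y} (zs , p , listing) =
      reverse zs , walk-reverse p ,
      Listing-resp-↭ (↭-trans (↭-sym (↭-reverse _)) (↭-reflexive reversed)) listing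
      where
      reversed : reverse (x ∷ zs ∷ʳ y) ≡ y ∷ reverse zs ∷ʳ x
      reversed = ≡.trans (unfold-reverse x (zs ∷ʳ y)) (cong (_∷ʳ x) (reverse-++ zs (y ∷ [])))

Edge-sym : ∀ G {i j} → Edge G i j → Edge G j i
Edge-sym G {i} {j} e = ≡.trans (Graph.sym G j i) e

Edge-irrefl : ∀ G {i j} → Edge G i j → i ≢ j
Edge-irrefl G {i} e refl with ≡.trans (≡.sym e) (irrefl G i)
... | ()

Edge-walk-reverse : ∀ G {i j ks} → Walk (Edge G) i j ks → Walk (Edge G) j i (reverse ks)
Edge-walk-reverse G = walk-reverse (λ {i} {j} → Edge-sym G {i} {j})

pathFromTo⇒walk : ∀ {G u w v ps} → Edge G u w → PathFromTo G w v ps →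
                  Σ[ zs ∈ List (Fin (order G)) ] ps ≡ zs ∷ʳ v × Walk (Edge G) u v zs
pathFromTo⇒walk e (single _) = [] , refl , edge e
pathFromTo⇒walk e (step e′ p) with pathFromTo⇒walk e′ p
... | zs , refl , q = _ ∷ zs , refl , via e q

hamiltonianPath⇒walk : ∀ {G u v} → u ≢ v → HamiltonianPath G u v → HamiltonianWalk (Edge G) u v
hamiltonianPath⇒walk u≢v (_ , single _ , _) = contradiction refl u≢v
hamiltonianPath⇒walk u≢v (u ∷ _ , step e p , listing) with pathFromTo⇒walk e p
... | zs , refl , q = zs , q , listing

walk⇒pathFromTo : ∀ {A : Set} {R : A → A → Set} H (f : A → Fin (order H)) →
                  (∀ {x y} → R x y → Edge H (f x) (f y)) →
                  ∀ {x y zs} → Walk R x y zs → PathFromTo H (f x) (f y) (map f (x ∷ zs ∷ʳ y))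
walk⇒pathFromTo H f f-edge (edge r)  = step (f-edge r) (single _)
walk⇒pathFromTo H f f-edge (via r p) = step (f-edge r) (walk⇒pathFromTo H f f-edge p)

module Mycielskian (G : Graph) where

  V : Set
  V = MVertex (order G)

  infix 4 _~_
  _~_ : V → V → Set
  U ~ W = mAdj (order G) (adj G) U W ≡ true

  ~-sym : ∀ {U W} → U ~ W → W ~ U
  ~-sym {U} {W} e = ≡.trans (mAdj-sym (order G) (adj G) (Graph.sym G) W U) e

  ~-walk-reverse : ∀ {U W zs} → Walk _~_ U W zs → Walk _~_ W U (reverse zs)
  ~-walk-reverse = walk-reverse (λ {U} {W} → ~-sym {U} {W})

  ~-hamiltonianWalk-reverse : ∀ {U W} → HamiltonianWalk _~_ U W → HamiltonianWalk _~_ W U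
  ~-hamiltonianWalk-reverse = hamiltonianWalk-reverse (λ {U} {W} → ~-sym {U} {W})

  side : Bool → Fin (order G) → V
  side true  = X
  side false = Y

  alt : Bool → List (Fin (order G)) → List V
  alt t []       = []
  alt t (i ∷ is) = side t i ∷ alt (not t) is

  lifted : List (Fin (order G)) → List V
  lifted []       = []
  lifted (i ∷ is) = X i ∷ Y i ∷ lifted is

  lifted-++ : ∀ is js → lifted (is ++ js) ≡ lifted is ++ lifted js
  lifted-++ []       js = refl
  lifted-++ (i ∷ is) js = cong (λ Us → X i ∷ Y i ∷ Us) (lifted-++ is js)

  alt-↭ : ∀ is → alt true is ++ alt false is ↭ lifted is
  alt-↭ []       = ↭-refl
  alt-↭ (i ∷ is) = begin
    X i ∷ alt false is ++ Y i ∷ alt true is  ↭⟨ prep (X i) (shift (Y i) (alt false is) (alt true is)) ⟩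
    X i ∷ Y i ∷ alt false is ++ alt true is  ↭⟨ prep (X i) (prep (Y i) (++-comm (alt false is) (alt true is))) ⟩
    X i ∷ Y i ∷ alt true is ++ alt false is  ↭⟨ prep (X i) (prep (Y i) (alt-↭ is)) ⟩
    X i ∷ Y i ∷ lifted is                    ∎
    where open PermutationReasoning

  side-∈-lifted⁺ : ∀ t {i is} → i ∈ is → side t i ∈ lifted is
  side-∈-lifted⁺ true  (here refl) = here refl
  side-∈-lifted⁺ false (here refl) = there (here refl)
  side-∈-lifted⁺ t     (there i∈)  = there (there (side-∈-lifted⁺ t i∈))

  side-∈-lifted⁻ : ∀ t {i is} → side t i ∈ lifted is → i ∈ is
  side-∈-lifted⁻ true  {is = _ ∷ _} (here refl)         = here refl
  side-∈-lifted⁻ true  {is = _ ∷ _} (there (here ()))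
  side-∈-lifted⁻ false {is = _ ∷ _} (here ())
  side-∈-lifted⁻ false {is = _ ∷ _} (there (here refl)) = here refl
  side-∈-lifted⁻ t     {is = _ ∷ _} (there (there U∈))  = there (side-∈-lifted⁻ t U∈)

  Z∉lifted : ∀ is → Z ∉ lifted is
  Z∉lifted (_ ∷ is) (there (there Z∈)) = Z∉lifted is Z∈

  unique-lifted : ∀ {is} → Unique is → Unique (lifted is)
  unique-lifted []                         = []
  unique-lifted {i ∷ is} (i≢is ∷ unique) =
    ((λ ()) ∷ ¬Any⇒All¬ _ (i∉is ∘ side-∈-lifted⁻ true)) ∷
    ¬Any⇒All¬ _ (i∉is ∘ side-∈-lifted⁻ false) ∷
    unique-lifted unique
    where
    i∉is : i ∉ is
    i∉is = Unique[x∷xs]⇒x∉xs (i≢is ∷ unique)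

  Listing-lifted : ∀ {is} → Listing is → Listing (Z ∷ lifted is)
  Listing-lifted {is} (unique , complete) =
    (¬Any⇒All¬ _ (Z∉lifted is) ∷ unique-lifted unique) , λ where
      (X i) → there (side-∈-lifted⁺ true (complete i))
      (Y i) → there (side-∈-lifted⁺ false (complete i))
      Z     → here refl

  Sees : Bool → V → Fin (order G) → Set
  Sees t U u = ∀ {w} → Edge G u w → U ~ side t w

  X-sees : ∀ t {u} → Sees t (X u) u
  X-sees true  e = e
  X-sees false e = e

  Y-sees-X : ∀ {u} → Sees true (Y u) u
  Y-sees-X e = e

  Z-sees-Y : ∀ {u} → Sees false Z u
  Z-sees-Y _ = refl

  side-sees : ∀ t {u} → Sees (not t) (side t u) u
  side-sees true  = X-sees false
  side-sees false = Y-sees-X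

  lift : ∀ {t U u v is} p → Sees t U u → odd (length is) ≡ p → Walk (Edge G) u v is →
         Walk _~_ U (side (p xor t) v) (alt t is)
  lift _ U-sees refl (edge e) = edge (U-sees e)
  lift {t} p U-sees is-parity (via {zs = is′} e w) =
    via (U-sees e) (subst (λ s → Walk _~_ _ (side s _) _) (not-xor-not p t)
                          (lift (not p) (side-sees t) is′-parity w))
    where
    is′-parity : odd (length is′) ≡ not p
    is′-parity = ≡.trans (≡.sym (not-involutive _)) (cong not is-parity)

  hamiltonian-by-↭ : ∀ {Us U W zs} → Listing Us → Walk _~_ U W zs → U ∷ W ∷ zs ↭ Us →
                     HamiltonianWalk _~_ U W
  hamiltonian-by-↭ {U = U} {W} {zs} listing w perm =
    zs , w , Listing-resp-↭ (↭-trans (↭-sym perm) (prep U (∷↭∷ʳ W zs))) listing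

  -- The monoid solver treats a reversed list as an atom of its own; these put it back.
  unreverseˡ : ∀ (as bs cs : List V) → reverse as ++ bs ++ cs ↭ as ++ bs ++ cs
  unreverseˡ as bs cs = ++⁺ʳ (bs ++ cs) (↭-reverse as)

  unreverseʳ : ∀ (as bs cs : List V) → as ++ reverse bs ++ cs ↭ as ++ bs ++ cs
  unreverseʳ as bs cs = ++⁺ˡ as (unreverseˡ bs [] cs)

module Ladders (G : Graph) where
  open Mycielskian G
  open CommutativeMonoidSolver (++-commutativeMonoid {A = V}) using (prove; Expr; _⊕_; var)

  record Ladder (p q : Fin (order G)) : Set where
    field
      {p′ q′}  : Fin (order G)
      {mid}    : List (Fin (order G))
      p-p′     : Edge G p p′
      p′⇝q′    : Walk (Edge G) p′ q′ mid
      q′-q     : Edge G q′ q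
      mid-odd  : odd (length mid) ≡ true
      listing  : Listing (p ∷ p′ ∷ mid ++ q′ ∷ q ∷ [])

    private
      p′-p : Edge G p′ p
      p′-p = Edge-sym G p-p′

      q-q′ : Edge G q q′
      q-q′ = Edge-sym G q′-q

      Xp′⇝Xq′ : Walk _~_ (X p′) (X q′) (alt false mid)
      Xp′⇝Xq′ = lift true (X-sees false) mid-odd p′⇝q′

      Yp′⇝Yq′ : Walk _~_ (Y p′) (Y q′) (alt true mid)
      Yp′⇝Yq′ = lift true Y-sees-X mid-odd p′⇝q′

      Z⇝Xq′ : Walk _~_ Z (X q′) (alt false mid)
      Z⇝Xq′ = lift true Z-sees-Y mid-odd p′⇝q′

      Ends : List V
      Ends = Z ∷ X p ∷ Y p ∷ X p′ ∷ Y p′ ∷ X q′ ∷ Y q′ ∷ X q ∷ Y q ∷ []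

      ρ : Vec (List V) 13
      ρ = alt true mid ∷ alt false mid ∷ reverse (alt true mid) ∷ reverse (alt false mid) ∷
          (Z ∷ []) ∷ (X p ∷ []) ∷ (Y p ∷ []) ∷ (X p′ ∷ []) ∷ (Y p′ ∷ []) ∷
          (X q′ ∷ []) ∷ (Y q′ ∷ []) ∷ (X q ∷ []) ∷ (Y q ∷ []) ∷ []

      T F rT rF z xp yp xp′ yp′ xq′ yq′ xq yq ends : Expr 13
      T = var (# 0); F = var (# 1); rT = var (# 2); rF = var (# 3)
      z = var (# 4); xp = var (# 5); yp = var (# 6); xp′ = var (# 7); yp′ = var (# 8)
      xq′ = var (# 9); yq′ = var (# 10); xq = var (# 11); yq = var (# 12)
      ends = z ⊕ (xp ⊕ (yp ⊕ (xp′ ⊕ (yp′ ⊕ (xq′ ⊕ (yq′ ⊕ (xq ⊕ yq)))))))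

      spine : Listing (alt true mid ++ alt false mid ++ Ends)
      spine = Listing-resp-↭ lifted↭spine (Listing-lifted listing)
        where
        open PermutationReasoning
        lifted↭spine : Z ∷ lifted (p ∷ p′ ∷ mid ++ q′ ∷ q ∷ []) ↭ alt true mid ++ alt false mid ++ Ends
        lifted↭spine = begin
          Z ∷ X p ∷ Y p ∷ X p′ ∷ Y p′ ∷ lifted (mid ++ q′ ∷ q ∷ [])
            ≡⟨ cong (λ Us → Z ∷ X p ∷ Y p ∷ X p′ ∷ Y p′ ∷ Us) (lifted-++ mid (q′ ∷ q ∷ [])) ⟩
          Z ∷ X p ∷ Y p ∷ X p′ ∷ Y p′ ∷ lifted mid ++ X q′ ∷ Y q′ ∷ X q ∷ Y q ∷ []
            ↭⟨ prep Z (prep (X p) (prep (Y p) (prep (X p′) (prep (Y p′) (++⁺ʳ _ (↭-sym (alt-↭ mid))))))) ⟩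
          Z ∷ X p ∷ Y p ∷ X p′ ∷ Y p′ ∷ (alt true mid ++ alt false mid) ++ X q′ ∷ Y q′ ∷ X q ∷ Y q ∷ []
            ↭⟨ prove 13 (z ⊕ (xp ⊕ (yp ⊕ (xp′ ⊕ (yp′ ⊕ ((T ⊕ F) ⊕ (xq′ ⊕ (yq′ ⊕ (xq ⊕ yq)))))))))
                        (T ⊕ (F ⊕ ends)) ρ ⟩
          alt true mid ++ alt false mid ++ Ends ∎

    ham-Yp⇝Xq : HamiltonianWalk _~_ (Y p) (X q)
    ham-Yp⇝Xq = hamiltonian-by-↭ spine
      (via refl (via refl (via q-q′ (~-walk-reverse Xp′⇝Xq′ ⊙ via p′-p (via p-p′ (Yp′⇝Yq′ ⊙ edge q′-q))))))
      (↭-trans (prove 13 (yp ⊕ (xq ⊕ (z ⊕ (yq ⊕ (xq′ ⊕ (rF ⊕ (xp′ ⊕ (xp ⊕ (yp′ ⊕ (T ⊕ yq′))))))))))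
                         (T ⊕ (rF ⊕ ends)) ρ)
               (unreverseʳ (alt true mid) (alt false mid) Ends))

    ham-Xq⇝Yq : HamiltonianWalk _~_ (X q) (Y q)
    ham-Xq⇝Yq = hamiltonian-by-↭ spine
      (via q-q′ (~-walk-reverse Yp′⇝Yq′ ⊙ via p′-p (via p-p′ (via p′-p (via refl (Z⇝Xq′ ⊙ edge q′-q))))))
      (↭-trans (prove 13 (xq ⊕ (yq ⊕ (yq′ ⊕ (rT ⊕ (yp′ ⊕ (xp ⊕ (xp′ ⊕ (yp ⊕ (z ⊕ (F ⊕ xq′))))))))))
                         (rT ⊕ (F ⊕ ends)) ρ)
               (unreverseˡ (alt true mid) (alt false mid) Ends))

    ham-Yp⇝Yq : HamiltonianWalk _~_ (Y p) (Y q)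
    ham-Yp⇝Yq = hamiltonian-by-↭ spine
      (via p-p′ (via p′-p (via p-p′ (Yp′⇝Yq′ ⊙ via q′-q (via q-q′ (~-walk-reverse Z⇝Xq′ ⊙ edge refl))))))
      (↭-trans (prove 13 (yp ⊕ (yq ⊕ (xp′ ⊕ (xp ⊕ (yp′ ⊕ (T ⊕ (yq′ ⊕ (xq ⊕ (xq′ ⊕ (rF ⊕ z))))))))))
                         (T ⊕ (rF ⊕ ends)) ρ)
               (unreverseʳ (alt true mid) (alt false mid) Ends))

    ham-Xp⇝Z : Edge G q p → HamiltonianWalk _~_ (X p) Z
    ham-Xp⇝Z q-p = hamiltonian-by-↭ spine
      (via p-p′ (Yp′⇝Yq′ ⊙ via q′-q (via q-p (via p-p′ (Xp′⇝Xq′ ⊙ via q′-q (edge refl))))))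
      (prove 13 (xp ⊕ (z ⊕ (yp′ ⊕ (T ⊕ (yq′ ⊕ (xq ⊕ (yp ⊕ (xp′ ⊕ (F ⊕ (xq′ ⊕ yq))))))))))
                (T ⊕ (F ⊕ ends)) ρ)

    ham-Yq⇝Z : Edge G q p → HamiltonianWalk _~_ (Y q) Z
    ham-Yq⇝Z q-p = hamiltonian-by-↭ spine
      (via q-p (via p-p′ (Yp′⇝Yq′ ⊙ via q′-q (via q-q′ (~-walk-reverse Xp′⇝Xq′ ⊙ via p′-p (edge refl))))))
      (↭-trans (prove 13 (yq ⊕ (z ⊕ (xp ⊕ (yp′ ⊕ (T ⊕ (yq′ ⊕ (xq ⊕ (xq′ ⊕ (rF ⊕ (xp′ ⊕ yp))))))))))
                         (T ⊕ (rF ⊕ ends)) ρ)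
               (unreverseʳ (alt true mid) (alt false mid) Ends))

  odd-length-ladder : ∀ {A : Set} (p p′ q′ q : A) mid →
                      odd (length (p ∷ p′ ∷ mid ++ q′ ∷ q ∷ [])) ≡ odd (length mid)
  odd-length-ladder p p′ q′ q mid = begin
    odd (suc (suc (length (mid ++ q′ ∷ q ∷ [])))) ≡⟨ odd-+2 (length (mid ++ q′ ∷ q ∷ [])) ⟩
    odd (length (mid ++ q′ ∷ q ∷ []))             ≡⟨ cong odd (length-++ mid) ⟩
    odd (length mid + 2)                          ≡⟨ odd-+ (length mid) 2 ⟩
    odd (length mid) xor false                    ≡⟨ xor-identityʳ _ ⟩
    odd (length mid)                              ∎
    where open ≡.≡-Reasoning

  hamiltonianWalk⇒ladder : odd (order G) ≡ true → ∀ {p q zs} → Walk (Edge G) p q zs →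
                           Listing (p ∷ zs ∷ʳ q) → 5 ≤ length (p ∷ zs ∷ʳ q) → Ladder p q
  hamiltonianWalk⇒ladder _ (edge _) _ (s≤s (s≤s ()))
  hamiltonianWalk⇒ladder _ (via {zs = zs} _ _) _ _ with initLast zs
  hamiltonianWalk⇒ladder _ (via _ _) _ (s≤s (s≤s (s≤s ()))) | []
  hamiltonianWalk⇒ladder order-odd {p} {q} (via {z = p′} p-p′ p′⇝q) listing _ | mid ∷ʳ′ q′
    with walk-split mid p′⇝q
  ... | p′⇝q′ , edge q′-q = record
    { p-p′    = p-p′
    ; p′⇝q′   = p′⇝q′
    ; q′-q    = q′-q
    ; mid-odd = ≡.trans (≡.sym (odd-length-ladder p p′ q′ q mid))
                        (≡.trans (cong odd (length-Listing listing′)) order-odd)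
    ; listing = listing′
    }
    where
    listing′ : Listing (p ∷ p′ ∷ mid ++ q′ ∷ q ∷ [])
    listing′ = subst (λ ks → Listing (p ∷ p′ ∷ ks)) (++-assoc mid (q′ ∷ []) (q ∷ [])) listing

module Cycles (G : Graph) where
  open Mycielskian G
  open CommutativeMonoidSolver (++-commutativeMonoid {A = V}) using (prove; Expr; _⊕_; var)

  -- A Hamiltonian cycle of G through a and b, cut at a and b into two arcs.
  record Arcs (a b : Fin (order G)) : Set where
    field
      {pre post} : List (Fin (order G))
      a⇝b        : Walk (Edge G) a b pre
      b⇝a        : Walk (Edge G) b a post
      listing    : Listing (a ∷ pre ++ b ∷ post)

  arcs-reverse : ∀ {a b} → Arcs a b → Arcs a b
  arcs-reverse {a} {b} arcs = record
    { a⇝b     = Edge-walk-reverse G b⇝a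
    ; b⇝a     = Edge-walk-reverse G a⇝b
    ; listing = Listing-resp-↭ (prep a reversal) listing
    }
    where
    open Arcs arcs
    open PermutationReasoning
    reversal : pre ++ b ∷ post ↭ reverse post ++ b ∷ reverse pre
    reversal = begin
      pre ++ b ∷ post                    ↭⟨ ↭-reverse (pre ++ b ∷ post) ⟨
      reverse (pre ++ b ∷ post)          ≡⟨ reverse-++ pre (b ∷ post) ⟩
      reverse (b ∷ post) ++ reverse pre  ≡⟨ cong (_++ reverse pre) (unfold-reverse b post) ⟩
      (reverse post ∷ʳ b) ++ reverse pre ≡⟨ ++-assoc (reverse post) (b ∷ []) (reverse pre) ⟩
      reverse post ++ b ∷ reverse pre    ∎

  odd-length-arcs : ∀ {A : Set} (a b : A) pre post →
                    odd (length (a ∷ pre ++ b ∷ post)) ≡ odd (length pre) xor odd (length post)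
  odd-length-arcs a b pre post = begin
    not (odd (length (pre ++ b ∷ post)))       ≡⟨ cong (not ∘ odd) (length-++ pre) ⟩
    not (odd (length pre + suc (length post))) ≡⟨ cong (not ∘ odd) (+-suc (length pre) (length post)) ⟩
    odd (suc (suc (length pre + length post))) ≡⟨ odd-+2 (length pre + length post) ⟩
    odd (length pre + length post)             ≡⟨ odd-+ (length pre) (length post) ⟩
    odd (length pre) xor odd (length post)     ∎
    where open ≡.≡-Reasoning

  arcs-parity : odd (order G) ≡ true → ∀ {a b} (arcs : Arcs a b) →
                odd (length (Arcs.pre arcs)) xor odd (length (Arcs.post arcs)) ≡ true
  arcs-parity order-odd {a} {b} arcs =
    ≡.trans (≡.sym (odd-length-arcs a b pre post)) (≡.trans (cong odd (length-Listing listing)) order-odd)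
    where open Arcs arcs

  -- Reversing the cycle swaps the arcs, so the one from a to b may be taken to be the even one.
  even-odd-arcs : odd (order G) ≡ true → ∀ {a b} → Arcs a b →
                  Σ[ arcs ∈ Arcs a b ] odd (length (Arcs.pre arcs)) ≡ false × odd (length (Arcs.post arcs)) ≡ true
  even-odd-arcs order-odd arcs with odd (length (Arcs.pre arcs)) in pre-parity | arcs-parity order-odd arcs
  ... | false | post-odd  = arcs , pre-parity , post-odd
  ... | true  | post-even =
    arcs-reverse arcs ,
    ≡.trans (cong odd (length-reverse post)) (≡.trans (≡.sym (not-involutive _)) (cong not post-even)) ,
    ≡.trans (cong odd (length-reverse pre)) pre-parity
    where open Arcs arcs

  module _ {a b} (arcs : Arcs a b) where
    open Arcs arcs

    private
      Ends : List V
      Ends = Z ∷ X a ∷ Y a ∷ X b ∷ Y b ∷ []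

      ρ : Vec (List V) 10
      ρ = alt false post ∷ reverse (alt false post) ∷ alt true post ∷ alt true pre ∷ alt false pre ∷
          (Z ∷ []) ∷ (X a ∷ []) ∷ (Y a ∷ []) ∷ (X b ∷ []) ∷ (Y b ∷ []) ∷ []

      Fpost rFpost Tpost Tpre Fpre z xa ya xb yb : Expr 10
      Fpost = var (# 0); rFpost = var (# 1); Tpost = var (# 2); Tpre = var (# 3); Fpre = var (# 4)
      z = var (# 5); xa = var (# 6); ya = var (# 7); xb = var (# 8); yb = var (# 9)

      spine : Listing (alt false post ++ alt true post ++ alt true pre ++ alt false pre ++ Ends)
      spine = Listing-resp-↭ lifted↭spine (Listing-lifted listing)
        where
        open PermutationReasoning
        lifted↭spine : Z ∷ lifted (a ∷ pre ++ b ∷ post) ↭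
                       alt false post ++ alt true post ++ alt true pre ++ alt false pre ++ Ends
        lifted↭spine = begin
          Z ∷ X a ∷ Y a ∷ lifted (pre ++ b ∷ post)
            ≡⟨ cong (λ Us → Z ∷ X a ∷ Y a ∷ Us) (lifted-++ pre (b ∷ post)) ⟩
          Z ∷ X a ∷ Y a ∷ lifted pre ++ X b ∷ Y b ∷ lifted post
            ↭⟨ prep Z (prep (X a) (prep (Y a)
                 (++⁺ (↭-sym (alt-↭ pre)) (prep (X b) (prep (Y b) (↭-sym (alt-↭ post))))))) ⟩
          Z ∷ X a ∷ Y a ∷ (alt true pre ++ alt false pre) ++ X b ∷ Y b ∷ alt true post ++ alt false post
            ↭⟨ prove 10 (z ⊕ (xa ⊕ (ya ⊕ ((Tpre ⊕ Fpre) ⊕ (xb ⊕ (yb ⊕ (Tpost ⊕ Fpost)))))))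
                        (Fpost ⊕ (Tpost ⊕ (Tpre ⊕ (Fpre ⊕ (z ⊕ (xa ⊕ (ya ⊕ (xb ⊕ yb)))))))) ρ ⟩
          alt false post ++ alt true post ++ alt true pre ++ alt false pre ++ Ends ∎

    ham-Xa⇝Xb : odd (length pre) ≡ false → odd (length post) ≡ true → HamiltonianWalk _~_ (X a) (X b)
    ham-Xa⇝Xb pre-even post-odd = hamiltonian-by-↭ spine
      (~-walk-reverse Z⇝Xa ⊙ Z⇝Yb ⊙ Yb⇝Ya ⊙ Ya⇝Xb)
      (↭-trans (prove 10 (xa ⊕ (xb ⊕ (rFpost ⊕ (z ⊕ (Fpre ⊕ (yb ⊕ (Tpost ⊕ (ya ⊕ Tpre))))))))
                         (rFpost ⊕ (Tpost ⊕ (Tpre ⊕ (Fpre ⊕ (z ⊕ (xa ⊕ (ya ⊕ (xb ⊕ yb)))))))) ρ)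
               (unreverseˡ (alt false post) (alt true post) (alt true pre ++ alt false pre ++ Ends)))
      where
      Z⇝Xa : Walk _~_ Z (X a) (alt false post)
      Z⇝Xa = lift true Z-sees-Y post-odd b⇝a
      Z⇝Yb : Walk _~_ Z (Y b) (alt false pre)
      Z⇝Yb = lift false Z-sees-Y pre-even a⇝b
      Yb⇝Ya : Walk _~_ (Y b) (Y a) (alt true post)
      Yb⇝Ya = lift true Y-sees-X post-odd b⇝a
      Ya⇝Xb : Walk _~_ (Y a) (X b) (alt true pre)
      Ya⇝Xb = lift false Y-sees-X pre-even a⇝b

module Hamiltonicity (G : Graph) (hc : HamiltonConnected G)
                     (order-odd : odd (order G) ≡ true) (5≤order : 5 ≤ order G) where
  open Mycielskian G
  open Ladders G
  open Cycles G

  hamiltonianWalk : ∀ {u v} → u ≢ v → HamiltonianWalk (Edge G) u v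
  hamiltonianWalk u≢v = hamiltonianPath⇒walk u≢v (hc _ _ u≢v)

  neighbour : ∀ u → ∃[ w ] Edge G u w
  neighbour u =
    let _ , u≢v     = another (≤-trans (s≤s (s≤s z≤n)) 5≤order) u
        _ , u⇝v , _ = hamiltonianWalk u≢v
    in first-step u⇝v

  ladder : ∀ {p q} → p ≢ q → Ladder p q
  ladder p≢q =
    let _ , p⇝q , listing = hamiltonianWalk p≢q
    in hamiltonianWalk⇒ladder order-odd p⇝q listing (subst (5 ≤_) (≡.sym (length-Listing listing)) 5≤order)

  arcs : ∀ {a b} → a ≢ b → Arcs a b
  arcs {a} {b} a≢b with neighbour a
  ... | a′ , a-a′ with hamiltonianWalk (Edge-irrefl G a-a′)
  ... | zs , a⇝a′ , listing with proj₂ listing b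
  ...   | here b≡a = contradiction (≡.sym b≡a) a≢b
  ...   | there b∈ with ∈-∃++ b∈
  ...     | pre , post , cut = record
    { a⇝b     = proj₁ (walk-split pre cycle)
    ; b⇝a     = proj₂ (walk-split pre cycle)
    ; listing = subst (λ ks → Listing (a ∷ ks)) cut listing
    }
    where
    cycle : Walk (Edge G) a a (pre ++ b ∷ post)
    cycle = subst (Walk (Edge G) a a) cut (a⇝a′ ⊙ edge (Edge-sym G a-a′))

  ~-hamiltonConnected : ∀ U W → U ≢ W → HamiltonianWalk _~_ U W
  ~-hamiltonConnected (X a) (X b) X≢X =
    let arcs , pre-even , post-odd = even-odd-arcs order-odd (arcs (X≢X ∘ cong X))
    in ham-Xa⇝Xb arcs pre-even post-odd
  ~-hamiltonConnected (X a) (Y b) _ with a ≟ b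
  ... | yes refl = let _ , a-a′ = neighbour a in Ladder.ham-Xq⇝Yq (ladder (Edge-irrefl G a-a′ ∘ ≡.sym))
  ... | no a≢b   = ~-hamiltonianWalk-reverse (Ladder.ham-Yp⇝Xq (ladder (a≢b ∘ ≡.sym)))
  ~-hamiltonConnected (X a) Z _ =
    let _ , a-a′ = neighbour a in Ladder.ham-Xp⇝Z (ladder (Edge-irrefl G a-a′)) (Edge-sym G a-a′)
  ~-hamiltonConnected (Y a) (X b) Y≢X =
    ~-hamiltonianWalk-reverse (~-hamiltonConnected (X b) (Y a) (Y≢X ∘ ≡.sym))
  ~-hamiltonConnected (Y a) (Y b) Y≢Y = Ladder.ham-Yp⇝Yq (ladder (Y≢Y ∘ cong Y))
  ~-hamiltonConnected (Y a) Z _ =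
    let _ , a-a′ = neighbour a in Ladder.ham-Yq⇝Z (ladder (Edge-irrefl G a-a′ ∘ ≡.sym)) a-a′
  ~-hamiltonConnected Z (X b) Z≢X =
    ~-hamiltonianWalk-reverse (~-hamiltonConnected (X b) Z (Z≢X ∘ ≡.sym))
  ~-hamiltonConnected Z (Y b) Z≢Y =
    ~-hamiltonianWalk-reverse (~-hamiltonConnected (Y b) Z (Z≢Y ∘ ≡.sym))
  ~-hamiltonConnected Z Z     Z≢Z = contradiction refl Z≢Z

index : ∀ n → MVertex n → Fin ((n + n) + 1)
index n (X i) = (i ↑ˡ n) ↑ˡ 1
index n (Y i) = (n ↑ʳ i) ↑ˡ 1
index n Z     = (n + n) ↑ʳ zero

classify-index : ∀ n U → classify n (index n U) ≡ U
classify-index n (X i) rewrite splitAt-↑ˡ (n + n) (i ↑ˡ n) 1 | splitAt-↑ˡ n i n = refl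
classify-index n (Y i) rewrite splitAt-↑ˡ (n + n) (n ↑ʳ i) 1 | splitAt-↑ʳ n n i = refl
classify-index n Z     rewrite splitAt-↑ʳ (n + n) 1 zero = refl

index-classify : ∀ n v → index n (classify n v) ≡ v
index-classify n v with splitAt (n + n) v in split
... | inj₂ zero = splitAt⁻¹-↑ʳ split
... | inj₁ w with splitAt n w in split′
...   | inj₁ i = ≡.trans (cong (_↑ˡ 1) (splitAt⁻¹-↑ˡ split′)) (splitAt⁻¹-↑ˡ split)
...   | inj₂ i = ≡.trans (cong (_↑ˡ 1) (splitAt⁻¹-↑ʳ split′)) (splitAt⁻¹-↑ˡ split)

module _ (G : Graph) where
  open Mycielskian G
  private
    n = order G

  classify-injective : ∀ {u v} → classify n u ≡ classify n v → u ≡ v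
  classify-injective {u} {v} eq =
    ≡.trans (≡.sym (index-classify n u)) (≡.trans (cong (index n) eq) (index-classify n v))

  index-injective : ∀ {U W} → index n U ≡ index n W → U ≡ W
  index-injective {U} {W} eq =
    ≡.trans (≡.sym (classify-index n U)) (≡.trans (cong (classify n) eq) (classify-index n W))

  index-edge : ∀ {U W} → U ~ W → Edge (mycielskian G) (index n U) (index n W)
  index-edge {U} {W} U~W rewrite classify-index n U | classify-index n W = U~W

  hamiltonianWalk⇒hamiltonianPath : ∀ {u v} → HamiltonianWalk _~_ (classify n u) (classify n v) →
                                    HamiltonianPath (mycielskian G) u v
  hamiltonianWalk⇒hamiltonianPath {u} {v} (zs , w , unique , complete) =
    map (index n) Us ,
    ≡.subst₂ (λ s t → PathFromTo (mycielskian G) s t (map (index n) Us))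
             (index-classify n u) (index-classify n v)
             (walk⇒pathFromTo (mycielskian G) (index n) (λ {U} {W} → index-edge {U} {W}) w) ,
    map⁺ index-injective unique ,
    λ x → subst (_∈ map (index n) Us) (index-classify n x) (∈-map⁺ (index n) (complete (classify n x)))
    where
    Us : List V
    Us = classify n u ∷ zs ∷ʳ classify n v

  mycielskian-hamiltonConnected : HamiltonConnected G → odd (order G) ≡ true → 5 ≤ order G →
                                  HamiltonConnected (mycielskian G)
  mycielskian-hamiltonConnected hc order-odd 5≤order u v u≢v =
    hamiltonianWalk⇒hamiltonianPath
      (Hamiltonicity.~-hamiltonConnected G hc order-odd 5≤order _ _ (u≢v ∘ classify-injective))

module Decide (G : Graph) where
  private
    n = order G
  open import Data.List.Membership.DecPropositional (_≟_ {n}) using (_∈?_)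
  open import Data.List.Relation.Unary.Unique.DecPropositional (_≟_ {n}) using (unique?)

  pathFromTo-head : ∀ {u v x xs} → PathFromTo G u v (x ∷ xs) → u ≡ x
  pathFromTo-head (single _) = refl
  pathFromTo-head (step _ _) = refl

  step⁻ : ∀ {u v x y ys} → PathFromTo G u v (x ∷ y ∷ ys) →
          u ≡ x × Edge G x y × PathFromTo G y v (y ∷ ys)
  step⁻ (step e p) with pathFromTo-head p
  ... | refl = refl , e , p

  pathFromTo? : ∀ u v ps → Dec (PathFromTo G u v ps)
  pathFromTo? u v []           = no λ ()
  pathFromTo? u v (x ∷ [])     =
    map′ (λ { (refl , refl) → single u }) (λ { (single _) → refl , refl }) (u ≟ x ×-dec x ≟ v)
  pathFromTo? u v (x ∷ y ∷ ps) =
    map′ (λ { (refl , e , p) → step e p }) step⁻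
         (u ≟ x ×-dec adj G x y Bool.≟ true ×-dec pathFromTo? y v (y ∷ ps))

  hamiltonianPath? : ∀ u v ps → Dec (PathFromTo G u v ps × Listing ps)
  hamiltonianPath? u v ps = pathFromTo? u v ps ×-dec unique? ps ×-dec all? (_∈? ps)

  Witnesses : List (List (Fin n)) → Set
  Witnesses pss = ∀ u v → u ≡ v ⊎ Any (λ ps → PathFromTo G u v ps × Listing ps) pss

  witnesses? : ∀ pss → Dec (Witnesses pss)
  witnesses? pss = all? λ u → all? λ v → u ≟ v ⊎-dec any? (hamiltonianPath? u v) pss

  hamiltonConnected-by : ∀ pss → True (witnesses? (pss ++ map reverse pss)) → HamiltonConnected G
  hamiltonConnected-by pss ok u v u≢v with toWitness ok u v
  ... | inj₁ u≡v   = contradiction u≡v u≢v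
  ... | inj₂ found = satisfied found

M1-hamiltonConnected : HamiltonConnected (Mycielski 1)
M1-hamiltonConnected = Decide.hamiltonConnected-by (Mycielski 1) [] _

M2-hamiltonConnected : HamiltonConnected (Mycielski 2)
M2-hamiltonConnected = Decide.hamiltonConnected-by (Mycielski 2) ((# 0 ∷ # 1 ∷ []) ∷ []) _

-- x₁ = # 0 and y₁ = # 2 are not adjacent on the 5-cycle M₃, so no ordering of its five
-- vertices is a Hamiltonian path between them.
M3-not-hamiltonConnected : ¬ HamiltonConnected (Mycielski 3)
M3-not-hamiltonConnected hc with hc (# 0) (# 2) (λ ())
... | ps , path , listing with length-Listing listing
M3-not-hamiltonConnected hc | a ∷ b ∷ c ∷ d ∷ e ∷ [] , path , listing | refl =
  toWitness {a? = all? λ a → all? λ b → all? λ c → all? λ d → all? λ e →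
                  ¬? (hamiltonianPath? (# 0) (# 2) (a ∷ b ∷ c ∷ d ∷ e ∷ []))} _
            a b c d e (path , listing)
  where open Decide (Mycielski 3)

-- A Hamiltonian path of the Grötzsch graph from u to v for every u < v, found by computer search.
grötzsch-paths : List (List ℕ)
grötzsch-paths =
  (0 ∷ 6 ∷ 2 ∷ 9 ∷ 3 ∷ 5 ∷ 10 ∷ 8 ∷ 4 ∷ 7 ∷ 1 ∷ [])
  ∷ (0 ∷ 6 ∷ 10 ∷ 8 ∷ 4 ∷ 7 ∷ 1 ∷ 5 ∷ 3 ∷ 9 ∷ 2 ∷ [])
  ∷ (0 ∷ 6 ∷ 2 ∷ 9 ∷ 10 ∷ 8 ∷ 4 ∷ 7 ∷ 1 ∷ 5 ∷ 3 ∷ [])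
  ∷ (0 ∷ 6 ∷ 2 ∷ 9 ∷ 3 ∷ 5 ∷ 1 ∷ 7 ∷ 10 ∷ 8 ∷ 4 ∷ [])
  ∷ (0 ∷ 1 ∷ 7 ∷ 4 ∷ 8 ∷ 10 ∷ 6 ∷ 2 ∷ 9 ∷ 3 ∷ 5 ∷ [])
  ∷ (0 ∷ 1 ∷ 7 ∷ 4 ∷ 8 ∷ 10 ∷ 5 ∷ 3 ∷ 9 ∷ 2 ∷ 6 ∷ [])
  ∷ (0 ∷ 1 ∷ 5 ∷ 3 ∷ 9 ∷ 2 ∷ 6 ∷ 10 ∷ 8 ∷ 4 ∷ 7 ∷ [])
  ∷ (0 ∷ 1 ∷ 5 ∷ 3 ∷ 9 ∷ 2 ∷ 6 ∷ 10 ∷ 7 ∷ 4 ∷ 8 ∷ [])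
  ∷ (0 ∷ 3 ∷ 5 ∷ 1 ∷ 7 ∷ 4 ∷ 8 ∷ 10 ∷ 6 ∷ 2 ∷ 9 ∷ [])
  ∷ (0 ∷ 6 ∷ 2 ∷ 9 ∷ 3 ∷ 5 ∷ 1 ∷ 7 ∷ 4 ∷ 8 ∷ 10 ∷ [])
  ∷ (1 ∷ 5 ∷ 3 ∷ 9 ∷ 10 ∷ 7 ∷ 4 ∷ 8 ∷ 0 ∷ 6 ∷ 2 ∷ [])
  ∷ (1 ∷ 5 ∷ 10 ∷ 7 ∷ 4 ∷ 8 ∷ 0 ∷ 6 ∷ 2 ∷ 9 ∷ 3 ∷ [])
  ∷ (1 ∷ 5 ∷ 3 ∷ 9 ∷ 2 ∷ 6 ∷ 0 ∷ 8 ∷ 10 ∷ 7 ∷ 4 ∷ [])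
  ∷ (1 ∷ 0 ∷ 8 ∷ 4 ∷ 7 ∷ 10 ∷ 6 ∷ 2 ∷ 9 ∷ 3 ∷ 5 ∷ [])
  ∷ (1 ∷ 0 ∷ 8 ∷ 4 ∷ 7 ∷ 10 ∷ 5 ∷ 3 ∷ 9 ∷ 2 ∷ 6 ∷ [])
  ∷ (1 ∷ 0 ∷ 6 ∷ 2 ∷ 9 ∷ 3 ∷ 5 ∷ 10 ∷ 8 ∷ 4 ∷ 7 ∷ [])
  ∷ (1 ∷ 0 ∷ 6 ∷ 2 ∷ 9 ∷ 3 ∷ 5 ∷ 10 ∷ 7 ∷ 4 ∷ 8 ∷ [])
  ∷ (1 ∷ 2 ∷ 6 ∷ 0 ∷ 8 ∷ 4 ∷ 7 ∷ 10 ∷ 5 ∷ 3 ∷ 9 ∷ [])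
  ∷ (1 ∷ 5 ∷ 3 ∷ 9 ∷ 2 ∷ 6 ∷ 0 ∷ 8 ∷ 4 ∷ 7 ∷ 10 ∷ [])
  ∷ (2 ∷ 6 ∷ 0 ∷ 8 ∷ 4 ∷ 7 ∷ 1 ∷ 5 ∷ 10 ∷ 9 ∷ 3 ∷ [])
  ∷ (2 ∷ 6 ∷ 0 ∷ 8 ∷ 10 ∷ 9 ∷ 3 ∷ 5 ∷ 1 ∷ 7 ∷ 4 ∷ [])
  ∷ (2 ∷ 1 ∷ 7 ∷ 4 ∷ 8 ∷ 0 ∷ 6 ∷ 10 ∷ 9 ∷ 3 ∷ 5 ∷ [])
  ∷ (2 ∷ 1 ∷ 5 ∷ 3 ∷ 9 ∷ 10 ∷ 7 ∷ 4 ∷ 8 ∷ 0 ∷ 6 ∷ [])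
  ∷ (2 ∷ 1 ∷ 5 ∷ 3 ∷ 9 ∷ 10 ∷ 6 ∷ 0 ∷ 8 ∷ 4 ∷ 7 ∷ [])
  ∷ (2 ∷ 4 ∷ 7 ∷ 1 ∷ 5 ∷ 3 ∷ 9 ∷ 10 ∷ 6 ∷ 0 ∷ 8 ∷ [])
  ∷ (2 ∷ 1 ∷ 7 ∷ 4 ∷ 8 ∷ 0 ∷ 6 ∷ 10 ∷ 5 ∷ 3 ∷ 9 ∷ [])
  ∷ (2 ∷ 6 ∷ 0 ∷ 8 ∷ 4 ∷ 7 ∷ 1 ∷ 5 ∷ 3 ∷ 9 ∷ 10 ∷ [])
  ∷ (3 ∷ 5 ∷ 1 ∷ 7 ∷ 10 ∷ 9 ∷ 2 ∷ 6 ∷ 0 ∷ 8 ∷ 4 ∷ [])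
  ∷ (3 ∷ 0 ∷ 6 ∷ 2 ∷ 9 ∷ 10 ∷ 8 ∷ 4 ∷ 7 ∷ 1 ∷ 5 ∷ [])
  ∷ (3 ∷ 0 ∷ 8 ∷ 4 ∷ 7 ∷ 1 ∷ 5 ∷ 10 ∷ 9 ∷ 2 ∷ 6 ∷ [])
  ∷ (3 ∷ 4 ∷ 8 ∷ 0 ∷ 6 ∷ 2 ∷ 9 ∷ 10 ∷ 5 ∷ 1 ∷ 7 ∷ [])
  ∷ (3 ∷ 0 ∷ 6 ∷ 2 ∷ 9 ∷ 10 ∷ 5 ∷ 1 ∷ 7 ∷ 4 ∷ 8 ∷ [])
  ∷ (3 ∷ 0 ∷ 8 ∷ 4 ∷ 7 ∷ 1 ∷ 5 ∷ 10 ∷ 6 ∷ 2 ∷ 9 ∷ [])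
  ∷ (3 ∷ 5 ∷ 1 ∷ 7 ∷ 4 ∷ 8 ∷ 0 ∷ 6 ∷ 2 ∷ 9 ∷ 10 ∷ [])
  ∷ (4 ∷ 3 ∷ 9 ∷ 2 ∷ 6 ∷ 0 ∷ 8 ∷ 10 ∷ 7 ∷ 1 ∷ 5 ∷ [])
  ∷ (4 ∷ 2 ∷ 9 ∷ 3 ∷ 5 ∷ 1 ∷ 7 ∷ 10 ∷ 8 ∷ 0 ∷ 6 ∷ [])
  ∷ (4 ∷ 2 ∷ 6 ∷ 0 ∷ 8 ∷ 10 ∷ 9 ∷ 3 ∷ 5 ∷ 1 ∷ 7 ∷ [])
  ∷ (4 ∷ 2 ∷ 9 ∷ 3 ∷ 5 ∷ 1 ∷ 7 ∷ 10 ∷ 6 ∷ 0 ∷ 8 ∷ [])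
  ∷ (4 ∷ 2 ∷ 6 ∷ 0 ∷ 8 ∷ 10 ∷ 7 ∷ 1 ∷ 5 ∷ 3 ∷ 9 ∷ [])
  ∷ (4 ∷ 7 ∷ 1 ∷ 5 ∷ 3 ∷ 9 ∷ 2 ∷ 6 ∷ 0 ∷ 8 ∷ 10 ∷ [])
  ∷ (5 ∷ 1 ∷ 0 ∷ 8 ∷ 10 ∷ 7 ∷ 4 ∷ 3 ∷ 9 ∷ 2 ∷ 6 ∷ [])
  ∷ (5 ∷ 1 ∷ 0 ∷ 3 ∷ 9 ∷ 2 ∷ 6 ∷ 10 ∷ 8 ∷ 4 ∷ 7 ∷ [])
  ∷ (5 ∷ 1 ∷ 0 ∷ 3 ∷ 9 ∷ 2 ∷ 6 ∷ 10 ∷ 7 ∷ 4 ∷ 8 ∷ [])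
  ∷ (5 ∷ 1 ∷ 2 ∷ 6 ∷ 0 ∷ 8 ∷ 10 ∷ 7 ∷ 4 ∷ 3 ∷ 9 ∷ [])
  ∷ (5 ∷ 1 ∷ 7 ∷ 4 ∷ 3 ∷ 9 ∷ 2 ∷ 6 ∷ 0 ∷ 8 ∷ 10 ∷ [])
  ∷ (6 ∷ 0 ∷ 1 ∷ 2 ∷ 9 ∷ 3 ∷ 5 ∷ 10 ∷ 8 ∷ 4 ∷ 7 ∷ [])
  ∷ (6 ∷ 0 ∷ 1 ∷ 2 ∷ 9 ∷ 3 ∷ 5 ∷ 10 ∷ 7 ∷ 4 ∷ 8 ∷ [])
  ∷ (6 ∷ 0 ∷ 3 ∷ 5 ∷ 1 ∷ 7 ∷ 10 ∷ 8 ∷ 4 ∷ 2 ∷ 9 ∷ [])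
  ∷ (6 ∷ 0 ∷ 8 ∷ 4 ∷ 2 ∷ 9 ∷ 3 ∷ 5 ∷ 1 ∷ 7 ∷ 10 ∷ [])
  ∷ (7 ∷ 1 ∷ 0 ∷ 6 ∷ 2 ∷ 9 ∷ 10 ∷ 5 ∷ 3 ∷ 4 ∷ 8 ∷ [])
  ∷ (7 ∷ 1 ∷ 0 ∷ 6 ∷ 2 ∷ 4 ∷ 8 ∷ 10 ∷ 5 ∷ 3 ∷ 9 ∷ [])
  ∷ (7 ∷ 1 ∷ 5 ∷ 3 ∷ 4 ∷ 8 ∷ 0 ∷ 6 ∷ 2 ∷ 9 ∷ 10 ∷ [])
  ∷ (8 ∷ 0 ∷ 1 ∷ 5 ∷ 3 ∷ 4 ∷ 7 ∷ 10 ∷ 6 ∷ 2 ∷ 9 ∷ [])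
  ∷ (8 ∷ 0 ∷ 6 ∷ 2 ∷ 4 ∷ 7 ∷ 1 ∷ 5 ∷ 3 ∷ 9 ∷ 10 ∷ [])
  ∷ (9 ∷ 2 ∷ 6 ∷ 0 ∷ 3 ∷ 5 ∷ 1 ∷ 7 ∷ 4 ∷ 8 ∷ 10 ∷ [])
  ∷ []

M4-hamiltonConnected : HamiltonConnected (Mycielski 4)
M4-hamiltonConnected = Decide.hamiltonConnected-by (Mycielski 4) (map (map (_mod 11)) grötzsch-paths) _

Mycielski-order≥2 : ∀ n → 2 ≤ order (Mycielski (suc (suc n)))
Mycielski-order≥2 zero    = s≤s (s≤s z≤n)
Mycielski-order≥2 (suc n) = ≤-trans (Mycielski-order≥2 n) (≤-trans (m≤m+n _ _) (m≤m+n _ 1))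

Mycielski-hamiltonConnected : ∀ n → HamiltonConnected (Mycielski (4 + n))
Mycielski-hamiltonConnected zero    = M4-hamiltonConnected
Mycielski-hamiltonConnected (suc n) =
  mycielskian-hamiltonConnected (Mycielski (4 + n)) (Mycielski-hamiltonConnected n)
    (odd-double+1 (order (Mycielski (3 + n))))
    (+-monoˡ-≤ 1 (+-mono-≤ (Mycielski-order≥2 (suc n)) (Mycielski-order≥2 (suc n))))

corollary16 : (n : ℕ) → n ≥ 1 → (HamiltonConnected (Mycielski n) ⇔ (¬ (n ≡ 3)))
corollary16 1 _ = mk⇔ (λ _ ()) (λ _ → M1-hamiltonConnected)
corollary16 2 _ = mk⇔ (λ _ ()) (λ _ → M2-hamiltonConnected)
corollary16 3 _ = mk⇔ (λ hc → contradiction hc M3-not-hamiltonConnected) (λ 3≢3 → contradiction refl 3≢3)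
corollary16 (suc (suc (suc (suc n)))) _ = mk⇔ (λ _ ()) (λ _ → Mycielski-hamiltonConnected n)
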